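{- Let $G$ be an interval graph and let $I$ and $J$ be two independent sets of $G$ of size $k$ with the same leftmost vertex $u$. Suppose a token-sliding sequence of moves $\mathcal{P}$ reconfigures $I$ into $J$ such that $u$ belongs to every independent set of the sequence. Then: (1) $\mathcal{P}$ yields a token-sliding reconfiguration from $I\setminus\{u\}$ to $J\setminus\{u\}$ in $G_u$; (2) for every vertex $v$ with $v\prec_r u$, the sequence of moves $\mathcal{P}$ yields a token-sliding reconfiguration from $(I\cup\{v\})\setminus\{u\}$ to $(J\cup\{v\})\setminus\{u\}$ in $G$.
   Context: Each vertex $x$ of $G$ is represented by an interval with left extremity $l(x)$ and right extremity $r(x)$, all extremities pairwise distinct; vertices are adjacent iff their intervals intersect. $x\prec_r y$ means $r(x)<r(y)$. $G_u$ is the subgraph induced by the vertices $v$ with $l(v)>r(u)$. The leftmost vertex of an independent set is the one with smallest left (equivalently right) extremity. A token-sliding reconfiguration is a sequence of independent sets of the same size in which consecutive sets $A,B$ satisfy $A\setminus B=\{x\}$, $B\setminus A=\{y\}$ with $xy$ an edge (the move slides $x$ to $y$). -}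

module Defs where

open import Data.Nat using (ℕ; _<_; _≤_)
open import Data.Fin using (Fin)
open import Data.Fin.Subset using (Subset; _∈_; ⁅_⁆; _─_; ∣_∣)
open import Data.List using (List; []; _∷_)
open import Data.Product using (Σ; _×_; ∃₂)
open import Relation.Binary.PropositionalEquality using (_≡_; _≢_)
open import Relation.Nullary using (¬_)
open import Data.Unit using (⊤)

-- An interval graph on vertex set Fin n, given by an interval model:
-- vertex x is the interval [l x , r x], all 2n extremities pairwise distinct.
record IntervalGraph (n : ℕ) : Set where
  field
    l r      : Fin n → ℕ
    l<r      : ∀ x → l x < r x
    l-inj    : ∀ x y → l x ≡ l y → x ≡ y
    r-inj    : ∀ x y → r x ≡ r y → x ≡ y
    l≢r      : ∀ x y → l x ≢ r y

module _ {n : ℕ} (G : IntervalGraph n) where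
  open IntervalGraph G

  Meet : Fin n → Fin n → Set
  Meet x y = (l x ≤ r y) × (l y ≤ r x)

  Adj : Fin n → Fin n → Set
  Adj x y = (x ≢ y) × Meet x y

  _≺r_ : Fin n → Fin n → Set
  x ≺r y = r x < r y

  Independent : Subset n → Set
  Independent A = ∀ x y → x ∈ A → y ∈ A → ¬ Adj x y

  Leftmost : Subset n → Fin n → Set
  Leftmost A u = (u ∈ A) × (∀ x → x ∈ A → x ≢ u → l u < l x)

  -- Induced subgraphs are given by a vertex predicate W.
  -- Whole graph G:
  AllV : Fin n → Set
  AllV _ = ⊤

  Gu : Fin n → Fin n → Set
  Gu u v = r u < l v

  IndepIn : (Fin n → Set) → ℕ → Subset n → Set
  IndepIn W k A = (∀ x → x ∈ A → W x) × Independent A × (∣ A ∣ ≡ k)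

  Slide : Subset n → Subset n → Set
  Slide A B = ∃₂ λ x y → Adj x y × (A ─ B ≡ ⁅ x ⁆) × (B ─ A ≡ ⁅ y ⁆)

  data TSSeq (W : Fin n → Set) (k : ℕ) : Subset n → Subset n → List (Subset n) → Set where
    done : ∀ {A} → IndepIn W k A → TSSeq W k A A (A ∷ [])
    step : ∀ {A B C P} → IndepIn W k A → Slide A B → TSSeq W k B C P →
           TSSeq W k A C (A ∷ P)

-- Every set S of the sequence consists of u together with vertices of G_u.
-- This holds for I because u is its leftmost vertex and I is independent,
-- and it survives a slide x ↦ y keeping u: y meets x, which lies right of
-- r(u), so y meets the span of u as well and independence forces l(y) > r(u).
-- Hence deleting u, or trading u for a vertex v with r(v) < r(u) (which
-- meets no vertex of G_u), keeps each set independent of the right size and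
-- leaves the differences A ─ B of consecutive sets, i.e. the moves, unchanged.
module Submission where

open import Defs
open import Data.Nat using (ℕ; suc; _∸_; pred; _<_)
open import Data.Nat.Properties using (<-trans; <-≤-trans; <⇒≤; <⇒≱; ≰⇒>; <-asym; suc-injective)
open import Data.Fin using (Fin; zero; suc)
open import Data.Fin.Subset
  using (Subset; inside; outside; _∈_; _∉_; _⊆_; ⁅_⁆; _∪_; _─_; _-_; ∣_∣)
open import Data.Fin.Subset.Properties
  using (_∈?_; ⊆-antisym; p─q⊆p; x∈p∧x∉q⇒x∈p─q; x∈p∪q⁻; p⊆p∪q; q⊆p∪q;
         x∈⁅x⁆; x∈⁅y⁆⇒x≡y; p─⊥≡p; ∪-identityʳ)
open import Data.List using (List; _∷_; map)
open import Data.List.Relation.Unary.All using (All; []; _∷_)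
open import Data.Product using (_×_; _,_; proj₁; proj₂)
open import Data.Sum using (inj₁; inj₂)
open import Data.Unit using (tt)
open import Data.Vec using (_∷_; here; there)
open import Function using (_∘_)
open import Relation.Binary.PropositionalEquality 
  using (_≡_; _≢_; refl; sym; trans; cong; subst; module ≡-Reasoning)
open import Relation.Nullary using (¬_; yes; no; contradiction)

private
  variable
    n : ℕ

x∈p─q⇒x∉q : ∀ {x : Fin n} (p q : Subset n) → x ∈ p ─ q → x ∉ q
x∈p─q⇒x∉q (_ ∷ p) (inside ∷ q) () here
x∈p─q⇒x∉q (_ ∷ p) (_ ∷ q) (there x∈p─q) (there x∈q) = x∈p─q⇒x∉q p q x∈p─q x∈q

x∈p-y⇒x≢y : ∀ {x y : Fin n} (p : Subset n) → x ∈ p - y → x ≢ y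
x∈p-y⇒x≢y {y = y} p x∈p-y refl = x∈p─q⇒x∉q p ⁅ y ⁆ x∈p-y (x∈⁅x⁆ y)

x∈p⇒⁅x⁆⊆p : ∀ {x : Fin n} {p : Subset n} → x ∈ p → ⁅ x ⁆ ⊆ p
x∈p⇒⁅x⁆⊆p {x = x} x∈p y∈⁅x⁆ = subst (_∈ _) (sym (x∈⁅y⁆⇒x≡y x y∈⁅x⁆)) x∈p

[p∪q]─r⊆[p─r]∪q : ∀ (p q r : Subset n) → (p ∪ q) ─ r ⊆ (p ─ r) ∪ q
[p∪q]─r⊆[p─r]∪q p q r x∈ with x∈p∪q⁻ p q (p─q⊆p (p ∪ q) r x∈)
... | inj₁ x∈p = p⊆p∪q q (x∈p∧x∉q⇒x∈p─q x∈p (x∈p─q⇒x∉q (p ∪ q) r x∈))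
... | inj₂ x∈q = q⊆p∪q (p ─ r) q x∈q

[p─r]─[q─r]≡p─q : ∀ (p q r : Subset n) → r ⊆ q → (p ─ r) ─ (q ─ r) ≡ p ─ q
[p─r]─[q─r]≡p─q p q r r⊆q = ⊆-antisym lhs⊆rhs rhs⊆lhs
  where
  lhs⊆rhs : (p ─ r) ─ (q ─ r) ⊆ p ─ q
  lhs⊆rhs x∈ = x∈p∧x∉q⇒x∈p─q (p─q⊆p p r x∈p─r) x∉q
    where
    x∈p─r = p─q⊆p (p ─ r) (q ─ r) x∈
    x∉q = x∈p─q⇒x∉q (p ─ r) (q ─ r) x∈ ∘ λ x∈q →
            x∈p∧x∉q⇒x∈p─q x∈q (x∈p─q⇒x∉q p r x∈p─r)
  rhs⊆lhs : p ─ q ⊆ (p ─ r) ─ (q ─ r)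
  rhs⊆lhs x∈ = x∈p∧x∉q⇒x∈p─q (x∈p∧x∉q⇒x∈p─q x∈p (x∉q ∘ r⊆q)) (x∉q ∘ p─q⊆p q r)
    where
    x∈p = p─q⊆p p q x∈
    x∉q = x∈p─q⇒x∉q p q x∈

[p∪r]─[q∪r]≡p─q : ∀ (p q r : Subset n) → (∀ {x} → x ∈ r → x ∉ p) →
                  (p ∪ r) ─ (q ∪ r) ≡ p ─ q
[p∪r]─[q∪r]≡p─q p q r disjoint = ⊆-antisym lhs⊆rhs rhs⊆lhs
  where
  lhs⊆rhs : (p ∪ r) ─ (q ∪ r) ⊆ p ─ q
  lhs⊆rhs x∈ with x∈p∪q⁻ p r (p─q⊆p (p ∪ r) (q ∪ r) x∈)
  ... | inj₁ x∈p = x∈p∧x∉q⇒x∈p─q x∈p (x∉q∪r ∘ p⊆p∪q r)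
    where x∉q∪r = x∈p─q⇒x∉q (p ∪ r) (q ∪ r) x∈
  ... | inj₂ x∈r = contradiction (q⊆p∪q q r x∈r) (x∈p─q⇒x∉q (p ∪ r) (q ∪ r) x∈)
  rhs⊆lhs : p ─ q ⊆ (p ∪ r) ─ (q ∪ r)
  rhs⊆lhs x∈ = x∈p∧x∉q⇒x∈p─q (p⊆p∪q r x∈p) x∉q∪r
    where
    x∈p = p─q⊆p p q x∈
    x∉q∪r : _ ∉ q ∪ r
    x∉q∪r x∈q∪r with x∈p∪q⁻ q r x∈q∪r
    ... | inj₁ x∈q = x∈p─q⇒x∉q p q x∈ x∈q
    ... | inj₂ x∈r = disjoint x∈r x∈p

suc∣p-x∣≡∣p∣ : ∀ {x : Fin n} {p : Subset n} → x ∈ p → suc ∣ p - x ∣ ≡ ∣ p ∣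
suc∣p-x∣≡∣p∣ {p = inside ∷ p} here = cong (suc ∘ ∣_∣) (p─⊥≡p p)
suc∣p-x∣≡∣p∣ {p = inside ∷ p} (there x∈p) = cong suc (suc∣p-x∣≡∣p∣ x∈p)
suc∣p-x∣≡∣p∣ {p = outside ∷ p} (there x∈p) = suc∣p-x∣≡∣p∣ x∈p

∣p∪⁅x⁆∣≡suc∣p∣ : ∀ {x : Fin n} {p : Subset n} → x ∉ p → ∣ p ∪ ⁅ x ⁆ ∣ ≡ suc ∣ p ∣
∣p∪⁅x⁆∣≡suc∣p∣ {x = zero} {p = inside ∷ p} x∉p = contradiction here x∉p
∣p∪⁅x⁆∣≡suc∣p∣ {x = zero} {p = outside ∷ p} _ = cong (suc ∘ ∣_∣) (∪-identityʳ p)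
∣p∪⁅x⁆∣≡suc∣p∣ {x = suc x} {p = inside ∷ p} x∉p = cong suc (∣p∪⁅x⁆∣≡suc∣p∣ (x∉p ∘ there))
∣p∪⁅x⁆∣≡suc∣p∣ {x = suc x} {p = outside ∷ p} x∉p = ∣p∪⁅x⁆∣≡suc∣p∣ (x∉p ∘ there)

module _ (G : IntervalGraph n) where
  open IntervalGraph G
  open ≡-Reasoning

  TSSeq-head : ∀ {W k A C P} → TSSeq G W k A C P → IndepIn G W k A
  TSSeq-head (done indA) = indA
  TSSeq-head (step indA _ _) = indA

  TSSeq-All-head : ∀ {W k A C P} {Q : Subset n → Set} → TSSeq G W k A C P → All Q P → Q A
  TSSeq-All-head (done _) (qA ∷ _) = qA
  TSSeq-All-head (step _ _ _) (qA ∷ _) = qA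

  slide-map : ∀ {A B} (f : Subset n → Subset n) →
              f A ─ f B ≡ A ─ B → f B ─ f A ≡ B ─ A → Slide G A B → Slide G (f A) (f B)
  slide-map f eqAB eqBA (x , y , xy , A─B , B─A) = x , y , xy , trans eqAB A─B , trans eqBA B─A

  TSSeq-map : ∀ {W W′ k k′} (Q : Subset n → Set) (f : Subset n → Subset n) →
              (∀ {S} → Q S → IndepIn G W k S → IndepIn G W′ k′ (f S)) →
              (∀ {A B} → Q A → Q B → f A ─ f B ≡ A ─ B) →
              ∀ {A C P} → TSSeq G W k A C P → All Q P →
              TSSeq G W′ k′ (f A) (f C) (map f P)
  TSSeq-map Q f indep diff (done indA) (qA ∷ _) = done (indep qA indA)
  TSSeq-map Q f indep diff (step indA A→B rest) (qA ∷ qs) =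
    step (indep qA indA) (slide-map f (diff qA qB) (diff qB qA) A→B) (TSSeq-map Q f indep diff rest qs)
    where qB = TSSeq-All-head rest qs

  independent-⊆ : ∀ {A B} → A ⊆ B → Independent G B → Independent G A
  independent-⊆ A⊆B indB x y x∈A y∈A = indB x y (A⊆B x∈A) (A⊆B y∈A)

  independent-∪⁅⁆ : ∀ {A v} → (∀ x → x ∈ A → r v < l x) → Independent G A →
                    Independent G (A ∪ ⁅ v ⁆)
  independent-∪⁅⁆ {A} {v} v<A indA x y x∈ y∈ (x≢y , lx≤ry , ly≤rx)
    with x∈p∪q⁻ A ⁅ v ⁆ x∈ | x∈p∪q⁻ A ⁅ v ⁆ y∈
  ... | inj₁ x∈A | inj₁ y∈A = indA x y x∈A y∈A (x≢y , lx≤ry , ly≤rx)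
  ... | inj₁ x∈A | inj₂ y∈v rewrite x∈⁅y⁆⇒x≡y v y∈v = <⇒≱ (v<A x x∈A) lx≤ry
  ... | inj₂ x∈v | inj₁ y∈A rewrite x∈⁅y⁆⇒x≡y v x∈v = <⇒≱ (v<A y y∈A) ly≤rx
  ... | inj₂ x∈v | inj₂ y∈v = x≢y (trans (x∈⁅y⁆⇒x≡y v x∈v) (sym (x∈⁅y⁆⇒x≡y v y∈v)))

  Anchored : Fin n → Subset n → Set
  Anchored u S = u ∈ S × (∀ x → x ∈ S → x ≢ u → Gu G u x)

  ¬Adj⇒Gu : ∀ {u x} → x ≢ u → ¬ Adj G u x → l u < r x → Gu G u x
  ¬Adj⇒Gu x≢u ¬ux lu<rx = ≰⇒> λ lx≤ru → ¬ux ((x≢u ∘ sym) , <⇒≤ lu<rx , lx≤ru)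

  leftmost⇒anchored : ∀ {S u} → Leftmost G S u → Independent G S → Anchored u S
  leftmost⇒anchored (u∈S , u-left) indS =
    u∈S , λ x x∈S x≢u → ¬Adj⇒Gu x≢u (indS _ x u∈S x∈S) (<-trans (u-left x x∈S x≢u) (l<r x))

  slide-anchored : ∀ {u A B} → Anchored u A → u ∈ B → Independent G B → Slide G A B → Anchored u B
  slide-anchored {u} {A} {B} (u∈A , A-right) u∈B indB (x₀ , y , (_ , lx₀≤ry , _) , A─B , B─A) =
    u∈B , B-right
    where
    x₀∈A─B : x₀ ∈ A ─ B
    x₀∈A─B = subst (x₀ ∈_) (sym A─B) (x∈⁅x⁆ x₀)
    x₀≢u : x₀ ≢ u
    x₀≢u refl = x∈p─q⇒x∉q A B x₀∈A─B u∈B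
    lu<ry : l u < r y
    lu<ry = <-≤-trans (<-trans (l<r u) (A-right x₀ (p─q⊆p A B x₀∈A─B) x₀≢u)) lx₀≤ry
    B-right : ∀ x → x ∈ B → x ≢ u → Gu G u x
    B-right x x∈B x≢u with x ∈? A
    ... | yes x∈A = A-right x x∈A x≢u
    ... | no x∉A = ¬Adj⇒Gu x≢u (indB u x u∈B x∈B) (subst (λ z → l u < r z) (sym x≡y) lu<ry)
      where x≡y = x∈⁅y⁆⇒x≡y y (subst (x ∈_) B─A (x∈p∧x∉q⇒x∈p─q x∈B x∉A))

  TSSeq-anchored : ∀ {W k u A C P} → TSSeq G W k A C P → All (u ∈_) P → Anchored u A →
                   All (Anchored u) P
  TSSeq-anchored (done _) _ ancA = ancA ∷ []
  TSSeq-anchored (step _ A→B rest) (_ ∷ u∈P) ancA =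
    ancA ∷ TSSeq-anchored rest u∈P
             (slide-anchored ancA (TSSeq-All-head rest u∈P) (proj₁ (proj₂ (TSSeq-head rest))) A→B)

  ≺r⇒∉anchored : ∀ {u v S} → _≺r_ G v u → Anchored u S → v ∉ S
  ≺r⇒∉anchored {u} {v} v≺u (_ , S-right) v∈S =
    <-asym v≺u (<-trans (S-right v v∈S v≢u) (l<r v))
    where
    v≢u : v ≢ u
    v≢u refl = <-asym v≺u v≺u

  anchored-delete : ∀ {W k u S} → Anchored u S → IndepIn G W k S →
                    IndepIn G (Gu G u) (k ∸ 1) (S - u)
  anchored-delete {S = S} (u∈S , S-right) (_ , indS , ∣S∣≡k) =
    (λ x x∈S-u → S-right x (p─q⊆p S _ x∈S-u) (x∈p-y⇒x≢y S x∈S-u)) ,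
    independent-⊆ (p─q⊆p S _) indS ,
    cong pred (trans (suc∣p-x∣≡∣p∣ u∈S) ∣S∣≡k)

  anchored-swap : ∀ {W k u v S} → _≺r_ G v u → Anchored u S → IndepIn G W k S →
                  IndepIn G (AllV G) k ((S ∪ ⁅ v ⁆) - u)
  anchored-swap {k = k} {u} {v} {S} v≺u ancS@(u∈S , S-right) (_ , indS , ∣S∣≡k) =
    (λ _ _ → tt) ,
    independent-⊆ ([p∪q]─r⊆[p─r]∪q S ⁅ v ⁆ ⁅ u ⁆)
                  (independent-∪⁅⁆ v-left (independent-⊆ (p─q⊆p S _) indS)) ,
    suc-injective size
    where
    v-left : ∀ x → x ∈ S - u → r v < l x
    v-left x x∈S-u = <-trans v≺u (S-right x (p─q⊆p S _ x∈S-u) (x∈p-y⇒x≢y S x∈S-u))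
    size : suc ∣ (S ∪ ⁅ v ⁆) - u ∣ ≡ suc k
    size = begin
      suc ∣ (S ∪ ⁅ v ⁆) - u ∣ ≡⟨ suc∣p-x∣≡∣p∣ (p⊆p∪q ⁅ v ⁆ u∈S) ⟩
      ∣ S ∪ ⁅ v ⁆ ∣           ≡⟨ ∣p∪⁅x⁆∣≡suc∣p∣ (≺r⇒∉anchored v≺u ancS) ⟩
      suc ∣ S ∣               ≡⟨ cong suc ∣S∣≡k ⟩
      suc k                   ∎

  anchored-swap-─ : ∀ {u v A B} → _≺r_ G v u → Anchored u A → Anchored u B →
                    ((A ∪ ⁅ v ⁆) - u) ─ ((B ∪ ⁅ v ⁆) - u) ≡ A ─ B
  anchored-swap-─ {u} {v} {A} {B} v≺u ancA (u∈B , _) = begin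
    ((A ∪ ⁅ v ⁆) - u) ─ ((B ∪ ⁅ v ⁆) - u)
      ≡⟨ [p─r]─[q─r]≡p─q (A ∪ ⁅ v ⁆) (B ∪ ⁅ v ⁆) ⁅ u ⁆ (x∈p⇒⁅x⁆⊆p (p⊆p∪q ⁅ v ⁆ u∈B)) ⟩
    (A ∪ ⁅ v ⁆) ─ (B ∪ ⁅ v ⁆)
      ≡⟨ [p∪r]─[q∪r]≡p─q A B ⁅ v ⁆ v∉A ⟩
    A ─ B ∎
    where
    v∉A : ∀ {x} → x ∈ ⁅ v ⁆ → x ∉ A
    v∉A x∈⁅v⁆ = subst (_∉ A) (sym (x∈⁅y⁆⇒x≡y v x∈⁅v⁆)) (≺r⇒∉anchored v≺u ancA)

lemma11 : ∀ {n : ℕ} (G : IntervalGraph n) (k : ℕ) (I J : Subset n) (u : Fin n)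
            (P : List (Subset n)) →
            Leftmost G I u → Leftmost G J u →
            TSSeq G (AllV G) k I J P →
            All (λ S → u ∈ S) P →
            TSSeq G (Gu G u) (k ∸ 1) (I - u) (J - u) (map (λ S → S - u) P)
            × (∀ v → _≺r_ G v u →
                 TSSeq G (AllV G) k ((I ∪ ⁅ v ⁆) - u) ((J ∪ ⁅ v ⁆) - u)
                   (map (λ S → (S ∪ ⁅ v ⁆) - u) P))
lemma11 G k I J u P u-leftmost-I _ I⇝J u∈P =
  TSSeq-map G (Anchored G u) (_- u) (anchored-delete G) delete-─ I⇝J anchored ,
  λ v v≺u → TSSeq-map G (Anchored G u) (λ S → (S ∪ ⁅ v ⁆) - u)
                      (anchored-swap G v≺u) (anchored-swap-─ G v≺u) I⇝J anchored
  where
  anchored : All (Anchored G u) P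
  anchored = TSSeq-anchored G I⇝J u∈P
               (leftmost⇒anchored G u-leftmost-I (proj₁ (proj₂ (TSSeq-head G I⇝J))))
  delete-─ : ∀ {A B} → Anchored G u A → Anchored G u B → (A - u) ─ (B - u) ≡ A ─ B
  delete-─ {A} {B} _ (u∈B , _) = [p─r]─[q─r]≡p─q A B ⁅ u ⁆ (x∈p⇒⁅x⁆⊆p u∈B)
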